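{- Let $p$ be a prime. Define polynomials $A_r(x),B_r(x)$ for $r\ge 0$ recursively by $A_0(x)=0$, $A_{r+1}(x)=(x+\dots+x^{p-1})^r-A_r(x)$, and $B_0(x)=0$, $B_{r+1}(x)=-(x+\dots+x^{p-1})^r-B_r(x)$. Put $f_r(x)=(x-1)(1+x^p+\dots+x^{p(p-1)})(x+\dots+x^{p-1})^r$. Then for every $r\ge 0$, $$f_r(x)=(-1)^r(x-1)(1+x^p+\dots+x^{p(p-1)})+x^{p^2}A_r(x)+B_r(x),$$ and for $r\ge 1$ the degree of $B_r(x)$ equals $(r-1)(p-1)$. -}

module Defs where

open import Data.Nat using (ℕ; zero; suc; _<_) renaming (_*_ to _*ℕ_; _∸_ to _∸ℕ_)
open import Data.Integer using (ℤ; +_; -_; _+_; _*_; _^_)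
open import Data.List using (List; []; _∷_; map; replicate; _++_)
open import Relation.Binary.PropositionalEquality using (_≡_; _≢_)
open import Data.Product using (_×_)

-- Polynomials with integer coefficients, as coefficient lists (constant term first).
-- Trailing zeros are allowed; equality is coefficientwise (_≈ₚ_).
Poly : Set
Poly = List ℤ

coeff : Poly → ℕ → ℤ
coeff []      _       = + 0
coeff (a ∷ _) zero    = a
coeff (_ ∷ q) (suc n) = coeff q n

infix 4 _≈ₚ_
_≈ₚ_ : Poly → Poly → Set
P ≈ₚ Q = ∀ n → coeff P n ≡ coeff Q n

infixl 6 _+ₚ_ _-ₚ_
infixl 7 _*ₚ_

_+ₚ_ : Poly → Poly → Poly
[]      +ₚ q       = q
(a ∷ p) +ₚ []      = a ∷ p
(a ∷ p) +ₚ (b ∷ q) = (a + b) ∷ (p +ₚ q)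

-ₚ_ : Poly → Poly
-ₚ p = map -_ p

_-ₚ_ : Poly → Poly → Poly
p -ₚ q = p +ₚ (-ₚ q)

_*ₚ_ : Poly → Poly → Poly
[]      *ₚ q = []
(a ∷ p) *ₚ q = map (a *_) q +ₚ (+ 0 ∷ (p *ₚ q))

const : ℤ → Poly
const c = c ∷ []

X^ : ℕ → Poly
X^ k = replicate k (+ 0) ++ (+ 1 ∷ [])

_^ₚ_ : Poly → ℕ → Poly
P ^ₚ zero  = const (+ 1)
P ^ₚ suc n = P *ₚ (P ^ₚ n)

sumₚ : (ℕ → Poly) → ℕ → Poly
sumₚ F zero    = []
sumₚ F (suc n) = sumₚ F n +ₚ F n

S : ℕ → Poly
S p = sumₚ (λ i → X^ (suc i)) (p ∸ℕ 1)

Φ : ℕ → Poly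
Φ p = sumₚ (λ i → X^ (p *ℕ i)) p

xm1 : Poly
xm1 = - (+ 1) ∷ + 1 ∷ []

A : ℕ → ℕ → Poly
A p zero    = []
A p (suc r) = (S p ^ₚ r) -ₚ A p r

B : ℕ → ℕ → Poly
B p zero    = []
B p (suc r) = (-ₚ (S p ^ₚ r)) -ₚ B p r

f : ℕ → ℕ → Poly
f p r = xm1 *ₚ Φ p *ₚ (S p ^ₚ r)

HasDegree : Poly → ℕ → Set
HasDegree P d = (coeff P d ≢ + 0) × (∀ n → d < n → coeff P n ≡ + 0)

{-# OPTIONS --safe #-}
-- Write s = x + ⋯ + x^(p-1) and Φ = 1 + x^p + ⋯ + x^(p(p-1)). Two geometric sums give
-- (x - 1)(1 + s) = x^p - 1 and (x^p - 1)Φ = x^(p²) - 1, hence (x - 1)Φs = (x^(p²) - 1) - (x - 1)Φ.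
-- Multiplying by s^r and substituting the expansion of f_r gives that of f_(r+1), with exactly the
-- recursions defining A_(r+1) and B_(r+1). For the degree: s^r has leading term x^(r(p-1)), which
-- strictly dominates B_r, so B_(r+1) = -s^r - B_r has leading term -x^(r(p-1)).
module Submission where

open import Defs

module PolynomialRing where
  open import Level using (0ℓ)
  open import Function using (_∘_)
  open import Data.Nat using (zero; suc)
  open import Data.Integer as ℤ using (ℤ; +_; -_; _+_; _*_)
  import Data.Integer.Properties as ℤₚ
  open import Data.List using ([]; _∷_; map)
  open import Data.List.Properties using (map-cong; map-∘; map-id)
  open import Data.Maybe as Maybe using ()
  open import Data.Product using (_,_)
  open import Relation.Binary.Bundles using (Setoid)
  open import Relation.Binary.Definitions using (WeaklyDecidable)
  open import Relation.Binary.PropositionalEquality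
    using (_≡_; refl; sym; trans; cong; cong₂; module ≡-Reasoning)
  open import Relation.Nullary.Decidable using (dec⇒maybe)
  open import Algebra.Bundles using (CommutativeRing)
  open import Algebra.Consequences.Propositional using (comm∧assoc⇒middleFour)
  open import Algebra.Solver.Ring.AlmostCommutativeRing
    using (fromCommutativeRing; _-Raw-AlmostCommutative⟶_)
  import Algebra.Consequences.Setoid
  import Algebra.Solver.Ring
  import Relation.Binary.Reasoning.Setoid as SetoidReasoning

  -- A record rather than the function type _≈ₚ_, so that Agda can infer P and Q.
  infix 4 _≃_
  record _≃_ (P Q : Poly) : Set where
    constructor coeffwise
    field coeff-≡ : P ≈ₚ Q
  open _≃_ public

  ≃-refl : ∀ {P} → P ≃ P
  ≃-refl = coeffwise λ _ → refl

  ≃-reflexive : ∀ {P Q} → P ≡ Q → P ≃ Q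
  ≃-reflexive refl = ≃-refl

  ≃-sym : ∀ {P Q} → P ≃ Q → Q ≃ P
  ≃-sym (coeffwise h) = coeffwise λ n → sym (h n)

  ≃-trans : ∀ {P Q R} → P ≃ Q → Q ≃ R → P ≃ R
  ≃-trans (coeffwise h) (coeffwise g) = coeffwise λ n → trans (h n) (g n)

  ≃-setoid : Setoid 0ℓ 0ℓ
  ≃-setoid = record
    { Carrier = Poly ; _≈_ = _≃_
    ; isEquivalence = record { refl = ≃-refl ; sym = ≃-sym ; trans = ≃-trans } }

  module ≃-Reasoning = SetoidReasoning ≃-setoid

  ∷-cong : ∀ {a b P Q} → a ≡ b → P ≃ Q → a ∷ P ≃ b ∷ Q
  ∷-cong a≡b (coeffwise h) = coeffwise λ { zero → a≡b ; (suc n) → h n }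

  infixr 7 _·ₚ_
  _·ₚ_ : ℤ → Poly → Poly
  a ·ₚ P = map (a *_) P

  shift : Poly → Poly
  shift P = + 0 ∷ P

  1ₚ : Poly
  1ₚ = const (+ 1)

  shift-cong : ∀ {P Q} → P ≃ Q → shift P ≃ shift Q
  shift-cong = ∷-cong refl

  shift-[] : ∀ {P} → P ≃ [] → shift P ≃ []
  shift-[] (coeffwise h) = coeffwise λ { zero → refl ; (suc n) → h n }

  coeff-+ₚ : ∀ P Q n → coeff (P +ₚ Q) n ≡ coeff P n + coeff Q n
  coeff-+ₚ []      Q       n       = sym (ℤₚ.+-identityˡ _)
  coeff-+ₚ (a ∷ P) []      n       = sym (ℤₚ.+-identityʳ _)
  coeff-+ₚ (a ∷ P) (b ∷ Q) zero    = refl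
  coeff-+ₚ (a ∷ P) (b ∷ Q) (suc n) = coeff-+ₚ P Q n

  coeff-negₚ : ∀ P n → coeff (-ₚ P) n ≡ - coeff P n
  coeff-negₚ []      n       = refl
  coeff-negₚ (a ∷ P) zero    = refl
  coeff-negₚ (a ∷ P) (suc n) = coeff-negₚ P n

  coeff-·ₚ : ∀ a P n → coeff (a ·ₚ P) n ≡ a * coeff P n
  coeff-·ₚ a []      n       = sym (ℤₚ.*-zeroʳ a)
  coeff-·ₚ a (b ∷ P) zero    = refl
  coeff-·ₚ a (b ∷ P) (suc n) = coeff-·ₚ a P n

  +ₚ-cong : ∀ {P P' Q Q'} → P ≃ P' → Q ≃ Q' → P +ₚ Q ≃ P' +ₚ Q'
  +ₚ-cong {P} {P'} {Q} {Q'} (coeffwise h) (coeffwise g) = coeffwise λ n → begin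
    coeff (P +ₚ Q) n       ≡⟨ coeff-+ₚ P Q n ⟩
    coeff P n + coeff Q n   ≡⟨ cong₂ _+_ (h n) (g n) ⟩
    coeff P' n + coeff Q' n ≡⟨ coeff-+ₚ P' Q' n ⟨
    coeff (P' +ₚ Q') n     ∎
    where open ≡-Reasoning

  negₚ-cong : ∀ {P Q} → P ≃ Q → -ₚ P ≃ -ₚ Q
  negₚ-cong {P} {Q} (coeffwise h) = coeffwise λ n →
    trans (coeff-negₚ P n) (trans (cong -_ (h n)) (sym (coeff-negₚ Q n)))

  ·ₚ-congʳ : ∀ a {P Q} → P ≃ Q → a ·ₚ P ≃ a ·ₚ Q
  ·ₚ-congʳ a {P} {Q} (coeffwise h) = coeffwise λ n →
    trans (coeff-·ₚ a P n) (trans (cong (a *_) (h n)) (sym (coeff-·ₚ a Q n)))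

  +ₚ-assoc : ∀ P Q R → (P +ₚ Q) +ₚ R ≡ P +ₚ (Q +ₚ R)
  +ₚ-assoc []      Q       R       = refl
  +ₚ-assoc (a ∷ P) []      R       = refl
  +ₚ-assoc (a ∷ P) (b ∷ Q) []      = refl
  +ₚ-assoc (a ∷ P) (b ∷ Q) (c ∷ R) = cong₂ _∷_ (ℤₚ.+-assoc a b c) (+ₚ-assoc P Q R)

  +ₚ-comm : ∀ P Q → P +ₚ Q ≡ Q +ₚ P
  +ₚ-comm []      []      = refl
  +ₚ-comm []      (b ∷ Q) = refl
  +ₚ-comm (a ∷ P) []      = refl
  +ₚ-comm (a ∷ P) (b ∷ Q) = cong₂ _∷_ (ℤₚ.+-comm a b) (+ₚ-comm P Q)

  +ₚ-identityʳ : ∀ P → P +ₚ [] ≡ P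
  +ₚ-identityʳ []      = refl
  +ₚ-identityʳ (a ∷ P) = refl

  +ₚ-inverseˡ : ∀ P → -ₚ P +ₚ P ≃ []
  +ₚ-inverseˡ P = coeffwise λ n → begin
    coeff (-ₚ P +ₚ P) n          ≡⟨ coeff-+ₚ (-ₚ P) P n ⟩
    coeff (-ₚ P) n + coeff P n   ≡⟨ cong (_+ coeff P n) (coeff-negₚ P n) ⟩
    - coeff P n + coeff P n      ≡⟨ ℤₚ.+-inverseˡ (coeff P n) ⟩
    + 0                          ∎
    where open ≡-Reasoning

  ·ₚ-identityˡ : ∀ P → + 1 ·ₚ P ≡ P
  ·ₚ-identityˡ P = trans (map-cong ℤₚ.*-identityˡ P) (map-id P)

  ·ₚ-zeroˡ : ∀ P → + 0 ·ₚ P ≃ []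
  ·ₚ-zeroˡ []      = ≃-refl
  ·ₚ-zeroˡ (a ∷ P) = shift-[] (·ₚ-zeroˡ P)

  ·ₚ-assoc : ∀ a b P → (a * b) ·ₚ P ≡ a ·ₚ (b ·ₚ P)
  ·ₚ-assoc a b P = trans (map-cong (ℤₚ.*-assoc a b) P) (map-∘ P)

  ·ₚ-distribʳ : ∀ a b P → (a + b) ·ₚ P ≡ a ·ₚ P +ₚ b ·ₚ P
  ·ₚ-distribʳ a b []      = refl
  ·ₚ-distribʳ a b (c ∷ P) = cong₂ _∷_ (ℤₚ.*-distribʳ-+ c a b) (·ₚ-distribʳ a b P)

  ·ₚ-distribˡ : ∀ a P Q → a ·ₚ (P +ₚ Q) ≡ a ·ₚ P +ₚ a ·ₚ Q
  ·ₚ-distribˡ a []      Q       = refl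
  ·ₚ-distribˡ a (b ∷ P) []      = refl
  ·ₚ-distribˡ a (b ∷ P) (c ∷ Q) = cong₂ _∷_ (ℤₚ.*-distribˡ-+ a b c) (·ₚ-distribˡ a P Q)

  ·ₚ-shift : ∀ a P → a ·ₚ shift P ≃ shift (a ·ₚ P)
  ·ₚ-shift a P = ∷-cong (ℤₚ.*-zeroʳ a) ≃-refl

  *ₚ-congʳ : ∀ P {Q Q'} → Q ≃ Q' → P *ₚ Q ≃ P *ₚ Q'
  *ₚ-congʳ []      Q≃Q' = ≃-refl
  *ₚ-congʳ (a ∷ P) Q≃Q' = +ₚ-cong (·ₚ-congʳ a Q≃Q') (shift-cong (*ₚ-congʳ P Q≃Q'))

  *ₚ-zeroʳ : ∀ P → P *ₚ [] ≃ []
  *ₚ-zeroʳ []      = ≃-refl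
  *ₚ-zeroʳ (a ∷ P) = shift-[] (*ₚ-zeroʳ P)

  *ₚ-∷ʳ : ∀ a P Q → Q *ₚ (a ∷ P) ≃ a ·ₚ Q +ₚ shift (Q *ₚ P)
  *ₚ-∷ʳ a P []      = ≃-sym (shift-[] ≃-refl)
  *ₚ-∷ʳ a P (b ∷ Q) = ∷-cong (cong (_+ + 0) (ℤₚ.*-comm b a)) (begin
    b ·ₚ P +ₚ Q *ₚ (a ∷ P)                ≈⟨ +ₚ-cong ≃-refl (*ₚ-∷ʳ a P Q) ⟩
    b ·ₚ P +ₚ (a ·ₚ Q +ₚ shift (Q *ₚ P))  ≡⟨ +ₚ-assoc (b ·ₚ P) _ _ ⟨
    b ·ₚ P +ₚ a ·ₚ Q +ₚ shift (Q *ₚ P)    ≡⟨ cong (_+ₚ shift (Q *ₚ P)) (+ₚ-comm (b ·ₚ P) _) ⟩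
    a ·ₚ Q +ₚ b ·ₚ P +ₚ shift (Q *ₚ P)    ≡⟨ +ₚ-assoc (a ·ₚ Q) _ _ ⟩
    a ·ₚ Q +ₚ (b ·ₚ P +ₚ shift (Q *ₚ P))  ∎)
    where open ≃-Reasoning

  *ₚ-comm : ∀ P Q → P *ₚ Q ≃ Q *ₚ P
  *ₚ-comm []      Q = ≃-sym (*ₚ-zeroʳ Q)
  *ₚ-comm (a ∷ P) Q = ≃-trans (+ₚ-cong ≃-refl (shift-cong (*ₚ-comm P Q))) (≃-sym (*ₚ-∷ʳ a P Q))

  *ₚ-cong : ∀ {P P' Q Q'} → P ≃ P' → Q ≃ Q' → P *ₚ Q ≃ P' *ₚ Q'
  *ₚ-cong {P} {P'} {Q} {Q'} P≃P' Q≃Q' =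
    ≃-trans (*ₚ-congʳ P Q≃Q') (≃-trans (*ₚ-comm P Q') (≃-trans (*ₚ-congʳ Q' P≃P') (*ₚ-comm Q' P')))

  *ₚ-identityˡ : ∀ P → 1ₚ *ₚ P ≃ P
  *ₚ-identityˡ []      = shift-[] ≃-refl
  *ₚ-identityˡ (a ∷ P) = ∷-cong (trans (ℤₚ.+-identityʳ _) (ℤₚ.*-identityˡ a))
                                (≃-reflexive (trans (+ₚ-identityʳ _) (·ₚ-identityˡ P)))

  shift-*ₚ : ∀ P Q → shift P *ₚ Q ≃ shift (P *ₚ Q)
  shift-*ₚ P Q = +ₚ-cong (·ₚ-zeroˡ Q) ≃-refl

  ·ₚ-*ₚ : ∀ a P Q → (a ·ₚ P) *ₚ Q ≃ a ·ₚ (P *ₚ Q)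
  ·ₚ-*ₚ a []      Q = ≃-refl
  ·ₚ-*ₚ a (b ∷ P) Q = begin
    (a * b) ·ₚ Q +ₚ shift ((a ·ₚ P) *ₚ Q)
      ≈⟨ +ₚ-cong (≃-reflexive (·ₚ-assoc a b Q)) (shift-cong (·ₚ-*ₚ a P Q)) ⟩
    a ·ₚ b ·ₚ Q +ₚ shift (a ·ₚ (P *ₚ Q))   ≈⟨ +ₚ-cong ≃-refl (≃-sym (·ₚ-shift a (P *ₚ Q))) ⟩
    a ·ₚ b ·ₚ Q +ₚ a ·ₚ shift (P *ₚ Q)     ≡⟨ ·ₚ-distribˡ a (b ·ₚ Q) _ ⟨
    a ·ₚ (b ·ₚ Q +ₚ shift (P *ₚ Q))        ∎
    where open ≃-Reasoning

  *ₚ-distribʳ : ∀ Q P P' → (P +ₚ P') *ₚ Q ≃ P *ₚ Q +ₚ P' *ₚ Q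
  *ₚ-distribʳ Q []      P'       = ≃-refl
  *ₚ-distribʳ Q (a ∷ P) []       = ≃-reflexive (sym (+ₚ-identityʳ _))
  *ₚ-distribʳ Q (a ∷ P) (b ∷ P') = begin
    (a + b) ·ₚ Q +ₚ shift ((P +ₚ P') *ₚ Q)
      ≈⟨ +ₚ-cong (≃-reflexive (·ₚ-distribʳ a b Q)) (shift-cong (*ₚ-distribʳ Q P P')) ⟩
    (a ·ₚ Q +ₚ b ·ₚ Q) +ₚ (shift (P *ₚ Q) +ₚ shift (P' *ₚ Q))
      ≡⟨ comm∧assoc⇒middleFour +ₚ-comm +ₚ-assoc (a ·ₚ Q) _ _ _ ⟩
    (a ·ₚ Q +ₚ shift (P *ₚ Q)) +ₚ (b ·ₚ Q +ₚ shift (P' *ₚ Q))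
      ∎
    where open ≃-Reasoning

  *ₚ-assoc : ∀ P Q R → (P *ₚ Q) *ₚ R ≃ P *ₚ (Q *ₚ R)
  *ₚ-assoc []      Q R = ≃-refl
  *ₚ-assoc (a ∷ P) Q R = begin
    (a ·ₚ Q +ₚ shift (P *ₚ Q)) *ₚ R             ≈⟨ *ₚ-distribʳ R (a ·ₚ Q) _ ⟩
    (a ·ₚ Q) *ₚ R +ₚ shift (P *ₚ Q) *ₚ R        ≈⟨ +ₚ-cong (·ₚ-*ₚ a Q R) (shift-*ₚ (P *ₚ Q) R) ⟩
    a ·ₚ (Q *ₚ R) +ₚ shift ((P *ₚ Q) *ₚ R)      ≈⟨ +ₚ-cong ≃-refl (shift-cong (*ₚ-assoc P Q R)) ⟩
    a ·ₚ (Q *ₚ R) +ₚ shift (P *ₚ (Q *ₚ R))      ∎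
    where open ≃-Reasoning

  ℤ[x] : CommutativeRing 0ℓ 0ℓ
  ℤ[x] = record
    { Carrier = Poly ; _≈_ = _≃_ ; _+_ = _+ₚ_ ; _*_ = _*ₚ_ ; -_ = -ₚ_ ; 0# = [] ; 1# = 1ₚ
    ; isCommutativeRing = record
      { isRing = record
        { +-isAbelianGroup = record
          { isGroup = record
            { isMonoid = record
              { isSemigroup = record
                { isMagma = record
                  { isEquivalence = Setoid.isEquivalence ≃-setoid ; ∙-cong = +ₚ-cong }
                ; assoc = λ P Q R → ≃-reflexive (+ₚ-assoc P Q R) }
              ; identity = (λ _ → ≃-refl) , λ P → ≃-reflexive (+ₚ-identityʳ P) }
            ; inverse = comm∧invˡ⇒inv (λ P Q → ≃-reflexive (+ₚ-comm P Q)) +ₚ-inverseˡ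
            ; ⁻¹-cong = negₚ-cong }
          ; comm = λ P Q → ≃-reflexive (+ₚ-comm P Q) }
        ; *-cong = *ₚ-cong
        ; *-assoc = *ₚ-assoc
        ; *-identity = comm∧idˡ⇒id *ₚ-comm *ₚ-identityˡ
        ; distrib = comm∧distrʳ⇒distr +ₚ-cong *ₚ-comm *ₚ-distribʳ }
      ; *-comm = *ₚ-comm } }
    where open Algebra.Consequences.Setoid ≃-setoid

  const-homomorphism : ℤ.+-*-rawRing -Raw-AlmostCommutative⟶ fromCommutativeRing ℤ[x]
  const-homomorphism = record
    { ⟦_⟧    = const
    ; +-homo = λ _ _ → ≃-refl
    ; *-homo = λ a b → ∷-cong (sym (ℤₚ.+-identityʳ (a * b))) ≃-refl
    ; -‿homo = λ _ → ≃-refl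
    ; 0-homo = shift-[] ≃-refl
    ; 1-homo = ≃-refl }

  const-≟ : WeaklyDecidable (λ a b → const a ≃ const b)
  const-≟ a b = Maybe.map (≃-reflexive ∘ cong const) (dec⇒maybe (a ℤ.≟ b))

  module ℤ[x]-Solver =
    Algebra.Solver.Ring ℤ.+-*-rawRing (fromCommutativeRing ℤ[x]) const-homomorphism const-≟

module Expansion where
  open PolynomialRing
  open import Data.Nat using (zero; suc; _+_; _*_)
  open import Data.Nat.Properties using (*-comm; *-identityʳ)
  open import Data.Integer using (+_; -_; _^_)
  open import Data.Integer.Properties using (-1*i≡-i)
  open import Data.List using ([])
  open import Relation.Binary.PropositionalEquality using (refl; cong)
  open import Algebra.Bundles using (CommutativeRing)
  open CommutativeRing ℤ[x] using (zeroʳ; -‿inverseʳ)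
  open ℤ[x]-Solver using (solve; _:=_; _:+_; _:*_; :-_; _:-_; con)
  open ≃-Reasoning

  sumₚ-cong : ∀ {F G} n → (∀ i → F i ≃ G i) → sumₚ F n ≃ sumₚ G n
  sumₚ-cong zero    F≃G = ≃-refl
  sumₚ-cong (suc n) F≃G = +ₚ-cong (sumₚ-cong n F≃G) (F≃G n)

  sumₚ-suc : ∀ F n → sumₚ F (suc n) ≃ F 0 +ₚ sumₚ (λ i → F (suc i)) n
  sumₚ-suc F zero    = ≃-reflexive (+ₚ-comm [] (F 0))
  sumₚ-suc F (suc n) = begin
    sumₚ F (suc n) +ₚ F (suc n)                   ≈⟨ +ₚ-cong (sumₚ-suc F n) ≃-refl ⟩
    F 0 +ₚ sumₚ (λ i → F (suc i)) n +ₚ F (suc n)  ≡⟨ +ₚ-assoc (F 0) _ _ ⟩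
    F 0 +ₚ sumₚ (λ i → F (suc i)) (suc n)         ∎

  geometric-sum : ∀ Y n → (Y -ₚ 1ₚ) *ₚ sumₚ (Y ^ₚ_) n ≃ Y ^ₚ n -ₚ 1ₚ
  geometric-sum Y zero    = ≃-trans (zeroʳ (Y -ₚ 1ₚ)) (≃-sym (-‿inverseʳ 1ₚ))
  geometric-sum Y (suc n) = begin
    (Y -ₚ 1ₚ) *ₚ (Σ +ₚ Yⁿ)
      ≈⟨ solve 3 (λ y s t → (y :- con (+ 1)) :* (s :+ t) := (y :- con (+ 1)) :* s :+ (y :* t :- t))
               ≃-refl Y Σ Yⁿ ⟩
    (Y -ₚ 1ₚ) *ₚ Σ +ₚ (Y *ₚ Yⁿ -ₚ Yⁿ)
      ≈⟨ +ₚ-cong (geometric-sum Y n) ≃-refl ⟩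
    (Yⁿ -ₚ 1ₚ) +ₚ (Y *ₚ Yⁿ -ₚ Yⁿ)
      ≈⟨ solve 2 (λ y t → (t :- con (+ 1)) :+ (y :* t :- t) := y :* t :- con (+ 1)) ≃-refl Y Yⁿ ⟩
    Y *ₚ Yⁿ -ₚ 1ₚ
      ∎
    where Σ  = sumₚ (Y ^ₚ_) n
          Yⁿ = Y ^ₚ n

  X^-+ : ∀ a b → X^ a *ₚ X^ b ≃ X^ (a + b)
  X^-+ zero    b = *ₚ-identityˡ (X^ b)
  X^-+ (suc a) b = ≃-trans (shift-*ₚ (X^ a) (X^ b)) (shift-cong (X^-+ a b))

  X^-^ : ∀ k i → X^ k ^ₚ i ≃ X^ (i * k)
  X^-^ k zero    = ≃-refl
  X^-^ k (suc i) = ≃-trans (*ₚ-congʳ (X^ k) (X^-^ k i)) (X^-+ k (i * k))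

  X^1-^ : ∀ i → X^ 1 ^ₚ i ≃ X^ i
  X^1-^ i = ≃-trans (X^-^ 1 i) (≃-reflexive (cong X^ (*-identityʳ i)))

  xm1*[1+S] : ∀ m → xm1 *ₚ (1ₚ +ₚ S (suc m)) ≃ X^ (suc m) -ₚ 1ₚ
  xm1*[1+S] m = begin
    xm1 *ₚ (1ₚ +ₚ S (suc m))
      ≈⟨ *ₚ-congʳ xm1 (+ₚ-cong ≃-refl (sumₚ-cong m λ i → ≃-sym (X^1-^ (suc i)))) ⟩
    xm1 *ₚ (1ₚ +ₚ sumₚ (λ i → X^ 1 ^ₚ suc i) m)
      ≈⟨ *ₚ-congʳ xm1 (≃-sym (sumₚ-suc (X^ 1 ^ₚ_) m)) ⟩
    (X^ 1 -ₚ 1ₚ) *ₚ sumₚ (X^ 1 ^ₚ_) (suc m)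
      ≈⟨ geometric-sum (X^ 1) (suc m) ⟩
    X^ 1 ^ₚ suc m -ₚ 1ₚ
      ≈⟨ +ₚ-cong (X^1-^ (suc m)) ≃-refl ⟩
    X^ (suc m) -ₚ 1ₚ
      ∎

  [X^p-1]*Φ : ∀ p → (X^ p -ₚ 1ₚ) *ₚ Φ p ≃ X^ (p * p) -ₚ 1ₚ
  [X^p-1]*Φ p = begin
    (X^ p -ₚ 1ₚ) *ₚ Φ p                ≈⟨ *ₚ-congʳ (X^ p -ₚ 1ₚ) (sumₚ-cong p X^[p*i]) ⟩
    (X^ p -ₚ 1ₚ) *ₚ sumₚ (X^ p ^ₚ_) p  ≈⟨ geometric-sum (X^ p) p ⟩
    X^ p ^ₚ p -ₚ 1ₚ                    ≈⟨ +ₚ-cong (X^-^ p p) ≃-refl ⟩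
    X^ (p * p) -ₚ 1ₚ                   ∎
    where X^[p*i] : ∀ i → X^ (p * i) ≃ X^ p ^ₚ i
          X^[p*i] i = ≃-sym (≃-trans (X^-^ p i) (≃-reflexive (cong X^ (*-comm i p))))

  xm1*Φ*S : ∀ p → xm1 *ₚ Φ p *ₚ S p ≃ (X^ (p * p) -ₚ 1ₚ) -ₚ xm1 *ₚ Φ p
  xm1*Φ*S zero      = coeffwise λ { zero → refl ; (suc zero) → refl ; (suc (suc n)) → refl }
  xm1*Φ*S p@(suc m) = begin
    xm1 *ₚ Φ p *ₚ S p
      ≈⟨ solve 3 (λ x φ s → x :* φ :* s := x :* (con (+ 1) :+ s) :* φ :- x :* φ)
               ≃-refl xm1 (Φ p) (S p) ⟩
    xm1 *ₚ (1ₚ +ₚ S p) *ₚ Φ p -ₚ xm1 *ₚ Φ p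
      ≈⟨ +ₚ-cong (*ₚ-cong (xm1*[1+S] m) ≃-refl) ≃-refl ⟩
    (X^ p -ₚ 1ₚ) *ₚ Φ p -ₚ xm1 *ₚ Φ p
      ≈⟨ +ₚ-cong ([X^p-1]*Φ p) ≃-refl ⟩
    (X^ (p * p) -ₚ 1ₚ) -ₚ xm1 *ₚ Φ p
      ∎

  f-expansion : ∀ p r → f p r ≃ const ((- (+ 1)) ^ r) *ₚ xm1 *ₚ Φ p +ₚ X^ (p * p) *ₚ A p r +ₚ B p r
  f-expansion p zero = begin
    xm1 *ₚ Φ p *ₚ 1ₚ
      ≈⟨ solve 2 (λ x φ → x :* φ :* con (+ 1) := con (+ 1) :* x :* φ) ≃-refl xm1 (Φ p) ⟩
    1ₚ *ₚ xm1 *ₚ Φ p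
      ≡⟨ +ₚ-identityʳ _ ⟨
    1ₚ *ₚ xm1 *ₚ Φ p +ₚ []
      ≈⟨ +ₚ-cong ≃-refl (≃-sym (zeroʳ W)) ⟩
    1ₚ *ₚ xm1 *ₚ Φ p +ₚ W *ₚ []
      ≡⟨ +ₚ-identityʳ _ ⟨
    1ₚ *ₚ xm1 *ₚ Φ p +ₚ W *ₚ [] +ₚ []
      ∎
    where W = X^ (p * p)
  f-expansion p (suc r) = begin
    xm1 *ₚ Φ p *ₚ (S p *ₚ T)
      ≈⟨ ≃-sym (*ₚ-assoc (xm1 *ₚ Φ p) (S p) T) ⟩
    xm1 *ₚ Φ p *ₚ S p *ₚ T
      ≈⟨ *ₚ-cong (xm1*Φ*S p) ≃-refl ⟩
    ((W -ₚ 1ₚ) -ₚ xm1 *ₚ Φ p) *ₚ T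
      ≈⟨ solve 4 (λ w x φ t → ((w :- con (+ 1)) :- x :* φ) :* t := (w :* t :- t) :- x :* φ :* t)
               ≃-refl W xm1 (Φ p) T ⟩
    (W *ₚ T -ₚ T) -ₚ f p r
      ≈⟨ +ₚ-cong ≃-refl (negₚ-cong (f-expansion p r)) ⟩
    (W *ₚ T -ₚ T) -ₚ (C *ₚ xm1 *ₚ Φ p +ₚ W *ₚ Aᵣ +ₚ Bᵣ)
      ≈⟨ solve 7 (λ w t c x φ a b → (w :* t :- t) :- (c :* x :* φ :+ w :* a :+ b)
                                  := (:- c) :* x :* φ :+ w :* (t :- a) :+ ((:- t) :- b))
               ≃-refl W T C xm1 (Φ p) Aᵣ Bᵣ ⟩
    -ₚ C *ₚ xm1 *ₚ Φ p +ₚ W *ₚ (T -ₚ Aᵣ) +ₚ ((-ₚ T) -ₚ Bᵣ)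
      ≡⟨ cong (λ c → const c *ₚ xm1 *ₚ Φ p +ₚ W *ₚ A p (suc r) +ₚ B p (suc r))
              (-1*i≡-i ((- (+ 1)) ^ r)) ⟨
    const ((- (+ 1)) ^ suc r) *ₚ xm1 *ₚ Φ p +ₚ W *ₚ A p (suc r) +ₚ B p (suc r)
      ∎
    where T  = S p ^ₚ r
          W  = X^ (p * p)
          C  = const ((- (+ 1)) ^ r)
          Aᵣ = A p r
          Bᵣ = B p r

module LeadingTerms where
  open PolynomialRing
  open import Data.Nat using (ℕ; zero; suc; _+_; _*_; _∸_; _<_; _≤_; z≤n; s≤s; NonTrivial; 2+)
  open import Data.Nat.Properties using (m≤n+m; m<n+m; n<1+n; <-trans)
  open import Data.Integer as ℤ using (ℤ; +_; -_)
  import Data.Integer.Properties as ℤₚ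
  open import Data.List using ([]; _∷_)
  open import Data.Product using (_,_)
  open import Relation.Binary.PropositionalEquality using (_≡_; _≢_; refl; sym; trans; cong; cong₂; subst)

  record HasLeadingTerm (P : Poly) (d : ℕ) (a : ℤ) : Set where
    constructor leading
    field
      top-coeff      : coeff P d ≡ a
      vanishes-above : ∀ n → d < n → coeff P n ≡ + 0

  leadingTerm⇒hasDegree : ∀ {P d a} → a ≢ + 0 → HasLeadingTerm P d a → HasDegree P d
  leadingTerm⇒hasDegree a≢0 (leading top above) = (λ top≡0 → a≢0 (trans (sym top) top≡0)) , above

  leadingTerm-resp-≃ : ∀ {P Q d a} → P ≃ Q → HasLeadingTerm P d a → HasLeadingTerm Q d a
  leadingTerm-resp-≃ (coeffwise P≈Q) (leading top above) =
    leading (trans (sym (P≈Q _)) top) λ n d<n → trans (sym (P≈Q n)) (above n d<n)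

  leadingTerm-lower : ∀ {P d e a} → HasLeadingTerm P e a → e < d → HasLeadingTerm P d (+ 0)
  leadingTerm-lower (leading _ above) e<d = leading (above _ e<d) λ n d<n → above n (<-trans e<d d<n)

  +ₚ-leadingTerm : ∀ {P Q d a b} → HasLeadingTerm P d a → HasLeadingTerm Q d b →
                   HasLeadingTerm (P +ₚ Q) d (a ℤ.+ b)
  +ₚ-leadingTerm {P} {Q} (leading topP aboveP) (leading topQ aboveQ) =
    leading (trans (coeff-+ₚ P Q _) (cong₂ ℤ._+_ topP topQ))
    λ n d<n → trans (coeff-+ₚ P Q n) (cong₂ ℤ._+_ (aboveP n d<n) (aboveQ n d<n))

  negₚ-leadingTerm : ∀ {P d a} → HasLeadingTerm P d a → HasLeadingTerm (-ₚ P) d (- a)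
  negₚ-leadingTerm {P} (leading top above) =
    leading (trans (coeff-negₚ P _) (cong -_ top))
    λ n d<n → trans (coeff-negₚ P n) (cong -_ (above n d<n))

  ·ₚ-leadingTerm : ∀ c {P d a} → HasLeadingTerm P d a → HasLeadingTerm (c ·ₚ P) d (c ℤ.* a)
  ·ₚ-leadingTerm c {P} (leading top above) =
    leading (trans (coeff-·ₚ c P _) (cong (c ℤ.*_) top))
    λ n d<n → trans (coeff-·ₚ c P n) (trans (cong (c ℤ.*_) (above n d<n)) (ℤₚ.*-zeroʳ c))

  shift-leadingTerm : ∀ {P d a} → HasLeadingTerm P d a → HasLeadingTerm (shift P) (suc d) a
  shift-leadingTerm (leading top above) = leading top λ { (suc n) (s≤s d<n) → above n d<n }

  X^-leadingTerm : ∀ k → HasLeadingTerm (X^ k) k (+ 1)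
  X^-leadingTerm zero    = leading refl λ { (suc n) _ → refl }
  X^-leadingTerm (suc k) = shift-leadingTerm (X^-leadingTerm k)

  *ₚ-leadingTerm : ∀ {P Q d e a b} → HasLeadingTerm P d a → HasLeadingTerm Q e b →
                   HasLeadingTerm (P *ₚ Q) (d + e) (a ℤ.* b)
  *ₚ-leadingTerm {[]}    (leading refl _) _ = leading refl λ _ _ → refl
  *ₚ-leadingTerm {c ∷ P} {Q} {zero} (leading refl above) leadQ =
    leadingTerm-resp-≃ c·Q≃ (·ₚ-leadingTerm c leadQ)
    where
      P≃[] : P ≃ []
      P≃[] = coeffwise λ n → above (suc n) (s≤s z≤n)
      c·Q≃ : c ·ₚ Q ≃ (c ∷ P) *ₚ Q
      c·Q≃ = ≃-trans (≃-reflexive (sym (+ₚ-identityʳ _)))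
                     (+ₚ-cong ≃-refl (≃-sym (shift-[] (*ₚ-cong P≃[] ≃-refl))))
  *ₚ-leadingTerm {c ∷ P} {Q} {suc d} {e} {a} (leading top above) leadQ =
    subst (HasLeadingTerm _ _) (ℤₚ.+-identityˡ _)
      (+ₚ-leadingTerm (leadingTerm-lower (·ₚ-leadingTerm c leadQ) (s≤s (m≤n+m e d)))
                      (shift-leadingTerm (*ₚ-leadingTerm {P} leadP leadQ)))
    where
      leadP : HasLeadingTerm P d a
      leadP = leading top λ n d<n → above (suc n) (s≤s d<n)

  S-leadingTerm : ∀ q → HasLeadingTerm (S (2+ q)) (suc q) (+ 1)
  S-leadingTerm zero    = X^-leadingTerm 1
  S-leadingTerm (suc q) =
    +ₚ-leadingTerm (leadingTerm-lower (S-leadingTerm q) (n<1+n _)) (X^-leadingTerm (2+ q))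

  S^-leadingTerm : ∀ q r → HasLeadingTerm (S (2+ q) ^ₚ r) (r * suc q) (+ 1)
  S^-leadingTerm q zero    = X^-leadingTerm 0
  S^-leadingTerm q (suc r) = *ₚ-leadingTerm (S-leadingTerm q) (S^-leadingTerm q r)

  B-leadingTerm : ∀ q k → HasLeadingTerm (B (2+ q) (suc k)) (k * suc q) (- + 1)
  B-leadingTerm q zero    = negₚ-leadingTerm (X^-leadingTerm 0)
  B-leadingTerm q (suc k) =
    +ₚ-leadingTerm (negₚ-leadingTerm (S^-leadingTerm q (suc k)))
                   (leadingTerm-lower (negₚ-leadingTerm (B-leadingTerm q k)) (m<n+m _ (s≤s z≤n)))

  B-hasDegree : ∀ p → .{{NonTrivial p}} → ∀ r → 1 ≤ r → HasDegree (B p r) ((r ∸ 1) * (p ∸ 1))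
  B-hasDegree (2+ q) (suc k) _ = leadingTerm⇒hasDegree (λ ()) (B-leadingTerm q k)

open import Data.Nat using (ℕ; _≤_; _*_; _∸_)
open import Data.Nat.Primality using (Prime; prime⇒nonTrivial)
open import Data.Integer using (-_; +_; _^_)
open import Data.Product using (_×_; _,_)
open PolynomialRing using (coeff-≡)
open Expansion using (f-expansion)
open LeadingTerms using (B-hasDegree)

mainTheorem17 : (p : ℕ) → Prime p →
    ((r : ℕ) → f p r ≈ₚ const ((- (+ 1)) ^ r) *ₚ xm1 *ₚ Φ p +ₚ X^ (p * p) *ₚ A p r +ₚ B p r)
    × ((r : ℕ) → 1 ≤ r → HasDegree (B p r) ((r ∸ 1) * (p ∸ 1)))
mainTheorem17 p p-prime = (λ r → coeff-≡ (f-expansion p r)) , B-hasDegree p {{prime⇒nonTrivial p-prime}}
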